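{- Let $(b,w)\in\mathbb{N}^2$. There exists a partition $\lambda$ with $(b(\lambda),w(\lambda))=(b,w)$ if and only if there exist nonnegative integers $k,l$ such that either $$(b,w)=\big((k+1)^2+l,\;k(k+1)+l\big)\quad\text{or}\quad (b,w)=\big(k^2+l,\;k(k+1)+l\big).$$
   Context: A partition is a finite nonincreasing sequence $\lambda=(\lambda_1\ge\dots\ge\lambda_r)$ of positive integers; the empty sequence is the partition of $0$. Its Ferrers graph consists of the unit squares in positions $(r',c)$ (row $r'\ge0$, column $c\ge 0$) with $0\le c<\lambda_{r'+1}$. A square is coloured black if $r'+c$ is even and white if $r'+c$ is odd. Here $b(\lambda)$ is the number of black squares and $w(\lambda)$ the number of white squares. -}

module Defs where

open import Data.Nat using (ℕ; zero; suc; _+_; _≤_; _<_; _%_; _≡ᵇ_)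
open import Data.Bool using (Bool; true; false; if_then_else_)
open import Data.List using (List; []; _∷_)
open import Data.List.Relation.Unary.All using (All)
open import Data.List.Relation.Unary.Linked using (Linked)
open import Data.Product using (_×_)

IsPartition : List ℕ → Set
IsPartition λs = All (λ x → 0 < x) λs × Linked (λ x y → y ≤ x) λs

isBlack : ℕ → ℕ → Bool
isBlack r c = ((r + c) % 2) ≡ᵇ 0

blackInRow : ℕ → ℕ → ℕ
blackInRow r zero    = 0
blackInRow r (suc m) = blackInRow r m + (if isBlack r m then 1 else 0)

whiteInRow : ℕ → ℕ → ℕ
whiteInRow r zero    = 0
whiteInRow r (suc m) = whiteInRow r m + (if isBlack r m then 0 else 1)

blackFrom : ℕ → List ℕ → ℕ
blackFrom r []       = 0
blackFrom r (m ∷ ms) = blackInRow r m + blackFrom (suc r) ms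

whiteFrom : ℕ → List ℕ → ℕ
whiteFrom r []       = 0
whiteFrom r (m ∷ ms) = whiteInRow r m + whiteFrom (suc r) ms

-- b(λ) and w(λ): rows are indexed from 0.
b : List ℕ → ℕ
b = blackFrom 0

w : List ℕ → ℕ
w = whiteFrom 0

-- The top row of a partition contributes ⌈m/2⌉ black and ⌊m/2⌋ white squares,
-- and the colours of all lower rows swap.  Hence every colour count is that of
-- a staircase (n, n-1, …, 1) plus some number l of dominoes, with n at most the
-- top row: adding a row m ≥ n on top yields the staircase of size n + 1 (if
-- m - n is odd) or max(n - 1, 0) (if m - n is even) plus more dominoes.
-- Conversely, l dominoes can be laid along the top row of a staircase.  The
-- staircases of size 2k + 1 and 2k have colour counts ((k+1)², k(k+1)) and
-- (k², k(k+1)).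
module Submission where

open import Defs
open import Data.Nat using (ℕ; zero; suc; _+_; _*_; _≤_; _<_; z≤n; s≤s; _%_; _≡ᵇ_)
open import Data.Nat.Properties
  using (+-suc; +-identityʳ; +-comm; *-suc; ≤-trans; n≤1+n; m≤m+n; +-commutativeSemigroup)
open import Algebra.Properties.CommutativeSemigroup +-commutativeSemigroup
  using (interchange; xy∙z≈xz∙y)
open import Data.Nat.Tactic.RingSolver using (solve-∀)
open import Data.Bool using (true; false; not)
open import Data.List using (List; []; _∷_)
open import Data.List.Relation.Unary.All using (All; []; _∷_)
open import Data.List.Relation.Unary.Linked using (Linked; []; [-]; _∷_)
open import Data.Product using (Σ; _×_; _,_; ∃₂; proj₁; proj₂; uncurry)
open import Data.Sum using (_⊎_; inj₁; inj₂)
open import Relation.Binary.PropositionalEquality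
  using (_≡_; refl; sym; trans; cong; cong₂; module ≡-Reasoning)
open import Function.Bundles using (_⇔_; mk⇔)

open ≡-Reasoning

data ParityView : ℕ → Set where
  even : ∀ t → ParityView (t * 2)
  odd  : ∀ t → ParityView (suc (t * 2))

parityView : ∀ n → ParityView n
parityView zero = even zero
parityView (suc n) with parityView n
... | even t = odd t
... | odd t  = even (suc t)

data Gap (n : ℕ) : ℕ → Set where
  even-gap : ∀ t → Gap n (n + t * 2)
  odd-gap  : ∀ t → Gap n (suc n + t * 2)

gap : ∀ {n m} → n ≤ m → Gap n m
gap {m = m} z≤n with parityView m
... | even t = even-gap t
... | odd t  = odd-gap t
gap (s≤s n≤m) with gap n≤m
... | even-gap t = even-gap t
... | odd-gap t  = odd-gap t

parity-suc : ∀ n → (suc n % 2 ≡ᵇ 0) ≡ not (n % 2 ≡ᵇ 0)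
parity-suc zero          = refl
parity-suc (suc zero)    = refl
parity-suc (suc (suc n)) = parity-suc n

isBlack-sucˡ : ∀ r c → isBlack (suc r) c ≡ not (isBlack r c)
isBlack-sucˡ r c = parity-suc (r + c)

isBlack-sucʳ : ∀ r c → isBlack r (suc c) ≡ not (isBlack r c)
isBlack-sucʳ r c rewrite +-suc r c = parity-suc (r + c)

blackInRow-sucˡ : ∀ r m → blackInRow (suc r) m ≡ whiteInRow r m
blackInRow-sucˡ r zero = refl
blackInRow-sucˡ r (suc m) rewrite blackInRow-sucˡ r m | isBlack-sucˡ r m
  with isBlack r m
... | true  = refl
... | false = refl

whiteInRow-sucˡ : ∀ r m → whiteInRow (suc r) m ≡ blackInRow r m
whiteInRow-sucˡ r zero = refl
whiteInRow-sucˡ r (suc m) rewrite whiteInRow-sucˡ r m | isBlack-sucˡ r m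
  with isBlack r m
... | true  = refl
... | false = refl

blackInRow-2+ : ∀ r m → blackInRow r (2 + m) ≡ suc (blackInRow r m)
blackInRow-2+ r m rewrite isBlack-sucʳ r m with isBlack r m
... | true  = trans (+-identityʳ _) (+-comm _ 1)
... | false = trans (cong (_+ 1) (+-identityʳ _)) (+-comm _ 1)

blackInRow-+-*2 : ∀ r m t → blackInRow r (m + t * 2) ≡ blackInRow r m + t
blackInRow-+-*2 r m zero =
  trans (cong (blackInRow r) (+-identityʳ m)) (sym (+-identityʳ _))
blackInRow-+-*2 r m (suc t) = begin
  blackInRow r (m + suc (suc (t * 2)))  ≡⟨ cong (blackInRow r) (trans (+-suc m _) (cong suc (+-suc m _))) ⟩
  blackInRow r (2 + (m + t * 2))        ≡⟨ blackInRow-2+ r _ ⟩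
  suc (blackInRow r (m + t * 2))        ≡⟨ cong suc (blackInRow-+-*2 r m t) ⟩
  suc (blackInRow r m + t)              ≡⟨ sym (+-suc _ t) ⟩
  blackInRow r m + suc t                ∎

whiteInRow-+-*2 : ∀ r m t → whiteInRow r (m + t * 2) ≡ whiteInRow r m + t
whiteInRow-+-*2 r m t = begin
  whiteInRow r (m + t * 2)          ≡⟨ sym (blackInRow-sucˡ r (m + t * 2)) ⟩
  blackInRow (suc r) (m + t * 2)    ≡⟨ blackInRow-+-*2 (suc r) m t ⟩
  blackInRow (suc r) m + t          ≡⟨ cong (_+ t) (blackInRow-sucˡ r m) ⟩
  whiteInRow r m + t                ∎

blackFrom-suc : ∀ r ms → blackFrom (suc r) ms ≡ whiteFrom r ms
whiteFrom-suc : ∀ r ms → whiteFrom (suc r) ms ≡ blackFrom r ms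
blackFrom-suc r [] = refl
blackFrom-suc r (m ∷ ms) = cong₂ _+_ (blackInRow-sucˡ r m) (blackFrom-suc (suc r) ms)
whiteFrom-suc r [] = refl
whiteFrom-suc r (m ∷ ms) = cong₂ _+_ (whiteInRow-sucˡ r m) (whiteFrom-suc (suc r) ms)

b-∷ : ∀ m ms → b (m ∷ ms) ≡ blackInRow 0 m + w ms
b-∷ m ms = cong (blackInRow 0 m +_) (blackFrom-suc 0 ms)

w-∷ : ∀ m ms → w (m ∷ ms) ≡ whiteInRow 0 m + b ms
w-∷ m ms = cong (whiteInRow 0 m +_) (whiteFrom-suc 0 ms)

staircase : ℕ → List ℕ
staircase zero    = []
staircase (suc n) = suc n ∷ staircase n

staircase-isPartition : ∀ n → IsPartition (staircase n)
staircase-isPartition n = positive n , decreasing n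
  where
  positive : ∀ n → All (0 <_) (staircase n)
  positive zero    = []
  positive (suc n) = s≤s z≤n ∷ positive n
  decreasing : ∀ n → Linked (λ x y → y ≤ x) (staircase n)
  decreasing zero          = []
  decreasing (suc zero)    = [-]
  decreasing (suc (suc n)) = n≤1+n _ ∷ decreasing (suc n)

staircase-even : ∀ k → b (staircase (k * 2)) ≡ k * k × w (staircase (k * 2)) ≡ k * suc k
staircase-odd  : ∀ k → b (staircase (suc (k * 2))) ≡ suc k * suc k
                     × w (staircase (suc (k * 2))) ≡ k * suc k
staircase-even zero = refl , refl
staircase-even (suc k) = black , white
  where
  black : b (staircase (suc k * 2)) ≡ suc k * suc k
  black = begin
    b (staircase (suc k * 2))                              ≡⟨ b-∷ (suc k * 2) (staircase (suc (k * 2))) ⟩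
    blackInRow 0 (suc k * 2) + w (staircase (suc (k * 2))) ≡⟨ cong₂ _+_ (blackInRow-+-*2 0 0 (suc k)) (proj₂ (staircase-odd k)) ⟩
    suc k + k * suc k                                      ∎
  white : w (staircase (suc k * 2)) ≡ suc k * suc (suc k)
  white = begin
    w (staircase (suc k * 2))                              ≡⟨ w-∷ (suc k * 2) (staircase (suc (k * 2))) ⟩
    whiteInRow 0 (suc k * 2) + b (staircase (suc (k * 2))) ≡⟨ cong₂ _+_ (whiteInRow-+-*2 0 0 (suc k)) (proj₁ (staircase-odd k)) ⟩
    suc k + suc k * suc k                                  ≡⟨ sym (*-suc (suc k) (suc k)) ⟩
    suc k * suc (suc k)                                    ∎
staircase-odd k = black , white
  where
  black : b (staircase (suc (k * 2))) ≡ suc k * suc k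
  black = begin
    b (staircase (suc (k * 2)))                          ≡⟨ b-∷ (suc (k * 2)) (staircase (k * 2)) ⟩
    blackInRow 0 (1 + k * 2) + w (staircase (k * 2))     ≡⟨ cong₂ _+_ (blackInRow-+-*2 0 1 k) (proj₂ (staircase-even k)) ⟩
    suc k + k * suc k                                    ∎
  white : w (staircase (suc (k * 2))) ≡ k * suc k
  white = begin
    w (staircase (suc (k * 2)))                          ≡⟨ w-∷ (suc (k * 2)) (staircase (k * 2)) ⟩
    whiteInRow 0 (1 + k * 2) + b (staircase (k * 2))     ≡⟨ cong₂ _+_ (whiteInRow-+-*2 0 1 k) (proj₁ (staircase-even k)) ⟩
    k + k * k                                            ≡⟨ sym (*-suc k k) ⟩
    k * suc k                                            ∎

data StaircaseWithDominoes (m bb ww : ℕ) : Set where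
  staircase+ : ∀ n l → n ≤ m → bb ≡ b (staircase n) + l → ww ≡ w (staircase n) + l →
               StaircaseWithDominoes m bb ww

StaircaseWithDominoes-mono : ∀ {m m′ bb ww} → m ≤ m′ →
  StaircaseWithDominoes m bb ww → StaircaseWithDominoes m′ bb ww
StaircaseWithDominoes-mono m≤m′ (staircase+ n l n≤m eb ew) =
  staircase+ n l (≤-trans n≤m m≤m′) eb ew

StaircaseWithDominoes-addRow : ∀ {m bb ww} → StaircaseWithDominoes m bb ww →
  StaircaseWithDominoes m (blackInRow 0 m + ww) (whiteInRow 0 m + bb)
StaircaseWithDominoes-addRow (staircase+ n l n≤m refl refl) with gap n≤m
... | odd-gap t = staircase+ (suc n) (t + l) (m≤m+n (suc n) (t * 2)) black white
  where
  black : blackInRow 0 (suc n + t * 2) + (w (staircase n) + l) ≡ b (staircase (suc n)) + (t + l)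
  black = begin
    blackInRow 0 (suc n + t * 2) + (w (staircase n) + l)   ≡⟨ cong (_+ (w (staircase n) + l)) (blackInRow-+-*2 0 (suc n) t) ⟩
    (blackInRow 0 (suc n) + t) + (w (staircase n) + l)     ≡⟨ interchange (blackInRow 0 (suc n)) t (w (staircase n)) l ⟩
    (blackInRow 0 (suc n) + w (staircase n)) + (t + l)     ≡⟨ cong (_+ (t + l)) (sym (b-∷ (suc n) (staircase n))) ⟩
    b (staircase (suc n)) + (t + l)                        ∎
  white : whiteInRow 0 (suc n + t * 2) + (b (staircase n) + l) ≡ w (staircase (suc n)) + (t + l)
  white = begin
    whiteInRow 0 (suc n + t * 2) + (b (staircase n) + l)   ≡⟨ cong (_+ (b (staircase n) + l)) (whiteInRow-+-*2 0 (suc n) t) ⟩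
    (whiteInRow 0 (suc n) + t) + (b (staircase n) + l)     ≡⟨ interchange (whiteInRow 0 (suc n)) t (b (staircase n)) l ⟩
    (whiteInRow 0 (suc n) + b (staircase n)) + (t + l)     ≡⟨ cong (_+ (t + l)) (sym (w-∷ (suc n) (staircase n))) ⟩
    w (staircase (suc n)) + (t + l)                        ∎
StaircaseWithDominoes-addRow (staircase+ zero l _ refl refl) | even-gap t =
  staircase+ zero (t + l) z≤n
    (cong (_+ l) (blackInRow-+-*2 0 0 t)) (cong (_+ l) (whiteInRow-+-*2 0 0 t))
StaircaseWithDominoes-addRow (staircase+ (suc p) l _ refl refl) | even-gap t =
  staircase+ p (B + W + t + l) (≤-trans (n≤1+n p) (m≤m+n (suc p) (t * 2))) black white
  where
  B W : ℕ
  B = blackInRow 0 (suc p)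
  W = whiteInRow 0 (suc p)
  black-regroup : ∀ B W S t l → (B + t) + ((W + S) + l) ≡ S + (B + W + t + l)
  black-regroup = solve-∀
  white-regroup : ∀ B W S t l → (W + t) + ((B + S) + l) ≡ S + (B + W + t + l)
  white-regroup = solve-∀
  black : blackInRow 0 (suc p + t * 2) + (w (staircase (suc p)) + l) ≡ b (staircase p) + (B + W + t + l)
  black = begin
    blackInRow 0 (suc p + t * 2) + (w (staircase (suc p)) + l)   ≡⟨ cong₂ (λ x y → x + (y + l)) (blackInRow-+-*2 0 (suc p) t) (w-∷ (suc p) (staircase p)) ⟩
    (B + t) + ((W + b (staircase p)) + l)                        ≡⟨ black-regroup B W (b (staircase p)) t l ⟩
    b (staircase p) + (B + W + t + l)                            ∎
  white : whiteInRow 0 (suc p + t * 2) + (b (staircase (suc p)) + l) ≡ w (staircase p) + (B + W + t + l)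
  white = begin
    whiteInRow 0 (suc p + t * 2) + (b (staircase (suc p)) + l)   ≡⟨ cong₂ (λ x y → x + (y + l)) (whiteInRow-+-*2 0 (suc p) t) (b-∷ (suc p) (staircase p)) ⟩
    (W + t) + ((B + w (staircase p)) + l)                        ≡⟨ white-regroup B W (w (staircase p)) t l ⟩
    w (staircase p) + (B + W + t + l)                            ∎

decompose : ∀ m ms → Linked (λ x y → y ≤ x) (m ∷ ms) →
  StaircaseWithDominoes m (b (m ∷ ms)) (w (m ∷ ms))
decompose m ms sorted rewrite b-∷ m ms | w-∷ m ms =
  StaircaseWithDominoes-addRow (below ms sorted)
  where
  below : ∀ ms → Linked (λ x y → y ≤ x) (m ∷ ms) → StaircaseWithDominoes m (b ms) (w ms)
  below []       _              = staircase+ zero zero z≤n refl refl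
  below (y ∷ ys) (y≤m ∷ sorted) = StaircaseWithDominoes-mono y≤m (decompose y ys sorted)

widen : ℕ → List ℕ → List ℕ
widen zero    ps       = ps
widen (suc l) []       = suc l * 2 ∷ []
widen (suc l) (m ∷ ms) = m + suc l * 2 ∷ ms

widen-isPartition : ∀ l ps → IsPartition ps → IsPartition (widen l ps)
widen-isPartition zero    ps       p                      = p
widen-isPartition (suc l) []       _                      = s≤s z≤n ∷ [] , [-]
widen-isPartition (suc l) (m ∷ ms) (0<m ∷ pos , [-])      = ≤-trans 0<m (m≤m+n m _) ∷ pos , [-]
widen-isPartition (suc l) (m ∷ ms) (0<m ∷ pos , r ∷ sorted) =
  ≤-trans 0<m (m≤m+n m _) ∷ pos , ≤-trans r (m≤m+n m _) ∷ sorted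

b-widen : ∀ l ps → b (widen l ps) ≡ b ps + l
b-widen zero    ps       = sym (+-identityʳ (b ps))
b-widen (suc l) []       = trans (+-identityʳ _) (blackInRow-+-*2 0 0 (suc l))
b-widen (suc l) (m ∷ ms) = begin
  blackInRow 0 (m + suc l * 2) + blackFrom 1 ms  ≡⟨ cong (_+ blackFrom 1 ms) (blackInRow-+-*2 0 m (suc l)) ⟩
  (blackInRow 0 m + suc l) + blackFrom 1 ms      ≡⟨ xy∙z≈xz∙y (blackInRow 0 m) (suc l) (blackFrom 1 ms) ⟩
  b (m ∷ ms) + suc l                             ∎

w-widen : ∀ l ps → w (widen l ps) ≡ w ps + l
w-widen zero    ps       = sym (+-identityʳ (w ps))
w-widen (suc l) []       = trans (+-identityʳ _) (whiteInRow-+-*2 0 0 (suc l))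
w-widen (suc l) (m ∷ ms) = begin
  whiteInRow 0 (m + suc l * 2) + whiteFrom 1 ms  ≡⟨ cong (_+ whiteFrom 1 ms) (whiteInRow-+-*2 0 m (suc l)) ⟩
  (whiteInRow 0 m + suc l) + whiteFrom 1 ms      ≡⟨ xy∙z≈xz∙y (whiteInRow 0 m) (suc l) (whiteFrom 1 ms) ⟩
  w (m ∷ ms) + suc l                             ∎

Realisable : ℕ → ℕ → Set
Realisable bb ww = Σ (List ℕ) λ ps → IsPartition ps × b ps ≡ bb × w ps ≡ ww

staircase+-realisable : ∀ n l {bb ww} → b (staircase n) ≡ bb → w (staircase n) ≡ ww →
  Realisable (bb + l) (ww + l)
staircase+-realisable n l refl refl =
  widen l (staircase n) , widen-isPartition l _ (staircase-isPartition n) ,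
  b-widen l (staircase n) , w-widen l (staircase n)

Admissible : ℕ → ℕ → Set
Admissible bb ww = ∃₂ λ (k l : ℕ) →
  ((bb ≡ suc k * suc k + l) × (ww ≡ k * suc k + l))
  ⊎ ((bb ≡ k * k + l) × (ww ≡ k * suc k + l))

StaircaseWithDominoes⇒Admissible : ∀ {m bb ww} → StaircaseWithDominoes m bb ww → Admissible bb ww
StaircaseWithDominoes⇒Admissible (staircase+ n l _ refl refl) with parityView n
... | even k = k , l , inj₂ (cong (_+ l) (proj₁ (staircase-even k)) , cong (_+ l) (proj₂ (staircase-even k)))
... | odd k  = k , l , inj₁ (cong (_+ l) (proj₁ (staircase-odd k)) , cong (_+ l) (proj₂ (staircase-odd k)))

theoremB : (bb ww : ℕ) →
    (Σ (List ℕ) λ ps → IsPartition ps × b ps ≡ bb × w ps ≡ ww)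
      ⇔ ∃₂ λ (k l : ℕ) →
          ((bb ≡ suc k * suc k + l) × (ww ≡ k * suc k + l))
          ⊎ ((bb ≡ k * k + l) × (ww ≡ k * suc k + l))
theoremB bb ww = mk⇔ necessary sufficient
  where
  necessary : Realisable bb ww → Admissible bb ww
  necessary ([]     , _            , refl , refl) = 0 , 0 , inj₂ (refl , refl)
  necessary (m ∷ ms , (_ , sorted) , refl , refl) =
    StaircaseWithDominoes⇒Admissible (decompose m ms sorted)
  sufficient : Admissible bb ww → Realisable bb ww
  sufficient (k , l , inj₁ (refl , refl)) = uncurry (staircase+-realisable (suc (k * 2)) l) (staircase-odd k)
  sufficient (k , l , inj₂ (refl , refl)) = uncurry (staircase+-realisable (k * 2) l) (staircase-even k)
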